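{- For $i\ge1$ let $\mathscr{A}_i(z)=\sum_{w}z^{|w|}V^{|w|_i}$, the sum over all Catalan words $w$ (including the empty word), and let $C=C(z)=\frac{1-\sqrt{1-4z}}{2z}$. Then \begin{align*} \mathscr{A}_1(z)&=\frac{1}{1-zVC},\qquad \mathscr{A}_2(z)=\frac{1-zVC}{1-zVC-z},\qquad \mathscr{A}_3(z)=\frac{1-zVC-z}{1-zVC-2z+z^2VC},\\ \mathscr{A}_4(z)&=\frac{1-zVC-2z+z^2VC}{1-zVC-3z+2z^2VC+z^2},\\ \mathscr{A}_5(z)&=\frac{1-zVC-3z+2z^2VC+z^2}{1-zVC-4z+3z^2VC+3z^2-z^3VC},\\ \mathscr{A}_6(z)&=\frac{1-zVC-4z+3z^2VC+3z^2-z^3VC}{1-zVC-5z+4z^2VC+6z^2-3z^3VC-z^3},\\ \mathscr{A}_7(z)&=\frac{1-zVC-5z+4z^2VC+6z^2-3z^3VC-z^3}{1-zVC-6z+5z^2VC+10z^2-6z^3VC-4z^3+z^4VC},\\ \mathscr{A}_8(z)&=\frac{1-zVC-6z+5z^2VC+10z^2-6z^3VC-4z^3+z^4VC}{1-zVC-7z+6z^2VC+15z^2-10z^3VC-10z^3+4z^4VC+z^4},\\ \mathscr{A}_9(z)&=\frac{1-zVC-7z+6z^2VC+15z^2-10z^3VC-10z^3+4z^4VC+z^4}{1-zVC-8z+7z^2VC+21z^2-15z^3VC-20z^3+10z^4VC+5z^4-z^5VC},\\ \mathscr{A}_{10}(z)&=\frac{1-zVC-8z+7z^2VC+21z^2-15z^3VC-20z^3+10z^4VC+5z^4-z^5VC}{1-zVC-9z+8z^2VC+28z^2-21z^3VC-35z^3+20z^4VC+15z^4-5z^5VC-z^5}.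 \end{align*}
   Context: A Catalan word of length $m\ge0$ is a word $a_1a_2\dots a_m$ over the positive integers with $a_1=1$ (if $m\ge1$) and $a_{i+1}\le a_i+1$ for all $1\le i<m$. For a word $w$, $|w|$ denotes its length and $|w|_i$ the number of occurrences of the letter $i$ in $w$. Thus $\mathscr{A}_i$ is the bivariate generating function of Catalan words with $z$ marking length and $V$ marking occurrences of the letter $i$; identities are as formal power series in $z$. -}

module Defs where

open import Data.Nat as ℕ using (ℕ; zero; suc; _∸_; _≡ᵇ_; _≤ᵇ_)
open import Data.Nat.Combinatorics using (_C_)
open import Data.Nat.DivMod using (_/_)
open import Data.Bool using (Bool; true; false; _∧_; if_then_else_)
open import Data.List using (List; []; _∷_; map; concatMap; upTo)
open import Data.Integer as ℤ using (ℤ; +_)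
open import Relation.Binary.PropositionalEquality using (_≡_)

steps : ℕ → List ℕ → Bool
steps prev []      = true
steps prev (b ∷ r) = (1 ≤ᵇ b) ∧ (b ≤ᵇ suc prev) ∧ steps b r

isCatalan : List ℕ → Bool
isCatalan []      = true
isCatalan (a ∷ r) = (a ≡ᵇ 1) ∧ steps a r

occ : ℕ → List ℕ → ℕ
occ i []      = 0
occ i (a ∷ w) = if a ≡ᵇ i then suc (occ i w) else occ i w

wordsOver : ℕ → ℕ → List (List ℕ)
wordsOver m zero    = [] ∷ []
wordsOver m (suc n) =
  concatMap (λ w → map (λ a → a ∷ w) (map suc (upTo m))) (wordsOver m n)

countIf : {A : Set} → (A → Bool) → List A → ℕ
countIf p []      = 0
countIf p (x ∷ xs) = if p x then suc (countIf p xs) else countIf p xs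

-- Formal power series in z with coefficients in ℤ[V]:
-- s n k = coefficient of z^n V^k.

Ser : Set
Ser = ℕ → ℕ → ℤ

_≈_ : Ser → Ser → Set
f ≈ g = ∀ n k → f n k ≡ g n k
infix 4 _≈_

sumTo : ℕ → (ℕ → ℤ) → ℤ
sumTo zero    f = f 0
sumTo (suc n) f = sumTo n f ℤ.+ f (suc n)

_⊕_ : Ser → Ser → Ser
(f ⊕ g) n k = f n k ℤ.+ g n k

_⊖_ : Ser → Ser → Ser
(f ⊖ g) n k = f n k ℤ.- g n k

_⊗_ : Ser → Ser → Ser
(f ⊗ g) n k = sumTo n (λ a → sumTo k (λ b → f a b ℤ.* g (n ∸ a) (k ∸ b)))

_·_ : ℕ → Ser → Ser
(c · f) n k = + c ℤ.* f n k

infixl 6 _⊕_ _⊖_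
infixl 7 _⊗_
infixr 8 _·_

one : Ser
one zero zero = + 1
one _    _    = + 0

zS : Ser
zS 1 zero = + 1
zS _ _    = + 0

vS : Ser
vS zero 1 = + 1
vS _    _ = + 0

zp : ℕ → Ser
zp zero    = one
zp (suc a) = zS ⊗ zp a

-- C(z) = (1 - √(1-4z)) / (2z) = Σ_n (2n choose n)/(n+1) zⁿ
cS : Ser
cS n zero = + (((2 ℕ.* n) C n) / suc n)
cS n (suc k) = + 0

-- 𝒜_i(z) = Σ_w z^{|w|} V^{|w|_i} over all Catalan words w.
-- A Catalan word of length n has all letters ≤ n, so the words of
-- length n are exactly the Catalan ones among wordsOver n n.
A : ℕ → Ser
A i n k = + countIf (λ w → isCatalan w ∧ (occ i w ≡ᵇ k)) (wordsOver n n)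

-- The numerators/denominators of the paper.  P j is the denominator of
-- 𝒜_j and the numerator of 𝒜_{j+1}; P 0 = 1.

zVC : ℕ → Ser
zVC a = zp a ⊗ vS ⊗ cS

P0 P1 P2 P3 P4 P5 P6 P7 P8 P9 P10 : Ser
P0 = one
P1 = one ⊖ zVC 1
P2 = one ⊖ zVC 1 ⊖ zp 1
P3 = one ⊖ zVC 1 ⊖ 2 · zp 1 ⊕ zVC 2
P4 = one ⊖ zVC 1 ⊖ 3 · zp 1 ⊕ 2 · zVC 2 ⊕ zp 2
P5 = one ⊖ zVC 1 ⊖ 4 · zp 1 ⊕ 3 · zVC 2 ⊕ 3 · zp 2 ⊖ zVC 3
P6 = one ⊖ zVC 1 ⊖ 5 · zp 1 ⊕ 4 · zVC 2 ⊕ 6 · zp 2 ⊖ 3 · zVC 3 ⊖ zp 3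
P7 = one ⊖ zVC 1 ⊖ 6 · zp 1 ⊕ 5 · zVC 2 ⊕ 10 · zp 2 ⊖ 6 · zVC 3 ⊖ 4 · zp 3
       ⊕ zVC 4
P8 = one ⊖ zVC 1 ⊖ 7 · zp 1 ⊕ 6 · zVC 2 ⊕ 15 · zp 2 ⊖ 10 · zVC 3 ⊖ 10 · zp 3
       ⊕ 4 · zVC 4 ⊕ zp 4
P9 = one ⊖ zVC 1 ⊖ 8 · zp 1 ⊕ 7 · zVC 2 ⊕ 21 · zp 2 ⊖ 15 · zVC 3 ⊖ 20 · zp 3
       ⊕ 10 · zVC 4 ⊕ 5 · zp 4 ⊖ zVC 5
P10 = one ⊖ zVC 1 ⊖ 9 · zp 1 ⊕ 8 · zVC 2 ⊕ 28 · zp 2 ⊖ 21 · zVC 3 ⊖ 35 · zp 3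
       ⊕ 20 · zVC 4 ⊕ 15 · zp 4 ⊖ 5 · zVC 5 ⊖ zp 5

-- Write T_i(j) for the generating function of the words that may follow the letter j in a
-- Catalan word, with V marking the letter i; then 𝒜_i = T_i(0). Splitting off the first letter
-- gives T_i(j) = 1 + z Σ_{b ≤ j} V^[b+1 = i] T_i(b+1), and splitting before the first letter 1
-- gives T_i(j+1) = T_{i-1}(j) T_i(0). With nothing marked, T_0(0) = C (its coefficients are the
-- ballot numbers), so 𝒜_1 = 1 + zVC 𝒜_1 and 𝒜_{i+1} = 1 + z 𝒜_i 𝒜_{i+1}. Hence 𝒜_i Q_i = Q_{i-1}
-- for Q_0 = 1, Q_1 = 1 - zVC, Q_{i+1} = Q_i - z Q_{i-1}, and the P_i of the statement are the
-- expanded Q_i.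
module Submission where

open import Algebra.Bundles using (CommutativeRing)
import Algebra.Construct.Pointwise as Pointwise
open import Algebra.Solver.Ring.AlmostCommutativeRing
  using (AlmostCommutativeRing; _-Raw-AlmostCommutative⟶_; fromCommutativeRing)
import Algebra.Solver.Ring
import Relation.Binary.Reasoning.Setoid
open import Data.Bool using (Bool; true; false; _∧_; if_then_else_)
open import Data.Fin using (zero; suc)
open import Data.Integer as ℤ using (ℤ; +_)
import Data.Integer.Properties as ℤ
import Data.Integer.Tactic.RingSolver as ℤ-Solver
open import Data.List using (List; []; _∷_; _++_; map; concatMap; applyUpTo; upTo)
import Data.List.Properties as List
open import Data.Maybe using (Maybe; just; nothing)
open import Data.Nat as ℕ using (ℕ; zero; suc; _∸_; _≤_; z≤n; s≤s; _≡ᵇ_; _<ᵇ_)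
open import Data.Nat.Combinatorics using (_C_; nCk≡nC[n∸k]; nCk+nC[k+1]≡[n+1]C[k+1]; nC1≡n)
open import Data.Nat.Combinatorics.Specification using (k>n⇒nCk≡0)
open import Data.Nat.DivMod using (_/_; m*n/n≡m)
import Data.Nat.Properties as ℕ
import Data.Nat.Tactic.RingSolver as ℕ-Solver
open import Data.Product using (_×_; _,_; proj₁; proj₂)
open import Data.Vec using (Vec; []; _∷_)
open import Function using (id)
open import Relation.Binary.PropositionalEquality as ≡ using (_≡_; cong)
open import Relation.Nullary using (yes; no)

-- Finite sums and convolution rings

module Sums {c ℓ} (R : CommutativeRing c ℓ) where

  open CommutativeRing R
  open import Algebra.Properties.CommutativeSemigroup +-commutativeSemigroup using (interchange)
  open import Relation.Binary.Reasoning.Setoid setoid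

  ∑ : ℕ → (ℕ → Carrier) → Carrier
  ∑ zero    f = f 0
  ∑ (suc n) f = ∑ n f + f (suc n)

  ∑-cong-≤ : ∀ n {f g : ℕ → Carrier} → (∀ a → a ≤ n → f a ≈ g a) → ∑ n f ≈ ∑ n g
  ∑-cong-≤ zero    f≈g = f≈g 0 z≤n
  ∑-cong-≤ (suc n) f≈g =
    +-cong (∑-cong-≤ n (λ a a≤n → f≈g a (ℕ.m≤n⇒m≤1+n a≤n))) (f≈g (suc n) ℕ.≤-refl)

  ∑-cong : ∀ n {f g : ℕ → Carrier} → (∀ a → f a ≈ g a) → ∑ n f ≈ ∑ n g
  ∑-cong n f≈g = ∑-cong-≤ n (λ a _ → f≈g a)

  ∑-distrib-+ : ∀ n (f g : ℕ → Carrier) → ∑ n (λ a → f a + g a) ≈ ∑ n f + ∑ n g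
  ∑-distrib-+ zero    f g = refl
  ∑-distrib-+ (suc n) f g = trans (+-congʳ (∑-distrib-+ n f g)) (interchange _ _ _ _)

  *-distribˡ-∑ : ∀ n x (f : ℕ → Carrier) → x * ∑ n f ≈ ∑ n (λ a → x * f a)
  *-distribˡ-∑ zero    x f = refl
  *-distribˡ-∑ (suc n) x f = trans (distribˡ x _ _) (+-congʳ (*-distribˡ-∑ n x f))

  *-distribʳ-∑ : ∀ n x (f : ℕ → Carrier) → ∑ n f * x ≈ ∑ n (λ a → f a * x)
  *-distribʳ-∑ zero    x f = refl
  *-distribʳ-∑ (suc n) x f = trans (distribʳ x _ _) (+-congʳ (*-distribʳ-∑ n x f))

  ∑-suc : ∀ n (f : ℕ → Carrier) → ∑ (suc n) f ≈ f 0 + ∑ n (λ a → f (suc a))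
  ∑-suc zero    f = refl
  ∑-suc (suc n) f = trans (+-congʳ (∑-suc n f)) (+-assoc _ _ _)

  ∑-head : ∀ n (f : ℕ → Carrier) → (∀ a → f (suc a) ≈ 0#) → ∑ n f ≈ f 0
  ∑-head zero    f f₊≈0 = refl
  ∑-head (suc n) f f₊≈0 = trans (+-cong (∑-head n f f₊≈0) (f₊≈0 n)) (+-identityʳ _)

  ∑-reverse : ∀ n (f : ℕ → Carrier) → ∑ n f ≈ ∑ n (λ a → f (n ∸ a))
  ∑-reverse zero    f = refl
  ∑-reverse (suc n) f = begin
    ∑ n f + f (suc n)                   ≈⟨ +-congʳ (∑-reverse n f) ⟩
    ∑ n (λ a → f (n ∸ a)) + f (suc n)   ≈⟨ +-comm _ _ ⟩
    f (suc n) + ∑ n (λ a → f (n ∸ a))   ≈⟨ ∑-suc n (λ a → f (suc n ∸ a)) ⟨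
    ∑ (suc n) (λ a → f (suc n ∸ a))     ∎

  -- Both sides sum F a b over the triangle a + b ≤ n, by rows and by diagonals.
  ∑-triangle : ∀ n (F : ℕ → ℕ → Carrier) →
    ∑ n (λ a → ∑ (n ∸ a) (F a)) ≈ ∑ n (λ m → ∑ m (λ a → F a (m ∸ a)))
  ∑-triangle zero    F = refl
  ∑-triangle (suc n) F = begin
    ∑ n (λ a → ∑ (suc n ∸ a) (F a)) + ∑ (suc n ∸ suc n) (F (suc n))
      ≈⟨ +-cong (∑-cong-≤ n (λ a a≤n → reflexive (cong (λ m → ∑ m (F a)) (ℕ.+-∸-assoc 1 a≤n))))
                (reflexive (cong (λ m → ∑ m (F (suc n))) (ℕ.n∸n≡0 n))) ⟩
    ∑ n (λ a → ∑ (n ∸ a) (F a) + F a (suc (n ∸ a))) + F (suc n) 0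
      ≈⟨ +-congʳ (∑-distrib-+ n _ _) ⟩
    (∑ n (λ a → ∑ (n ∸ a) (F a)) + ∑ n (λ a → F a (suc (n ∸ a)))) + F (suc n) 0
      ≈⟨ +-assoc _ _ _ ⟩
    ∑ n (λ a → ∑ (n ∸ a) (F a)) + (∑ n (λ a → F a (suc (n ∸ a))) + F (suc n) 0)
      ≈⟨ +-cong (∑-triangle n F)
                (+-cong (∑-cong-≤ n (λ a a≤n → reflexive (cong (F a) (≡.sym (ℕ.+-∸-assoc 1 a≤n)))))
                        (reflexive (cong (F (suc n)) (≡.sym (ℕ.n∸n≡0 n))))) ⟩
    ∑ n (λ m → ∑ m (λ a → F a (m ∸ a))) + ∑ (suc n) (λ a → F a (suc n ∸ a))  ∎

module Convolution {c ℓ} (R : CommutativeRing c ℓ) where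

  open CommutativeRing R
  open import Algebra.Properties.Ring ring using (-0#≈0#)
  open import Relation.Binary.Reasoning.Setoid setoid
  open Sums R public

  Series : Set c
  Series = ℕ → Carrier

  infix  4 _≋_
  infixl 7 _⋆_

  _≋_ : Series → Series → Set ℓ
  f ≋ g = ∀ n → f n ≈ g n

  _⋆_ : Series → Series → Series
  (f ⋆ g) n = ∑ n (λ a → f a * g (n ∸ a))

  ι : Carrier → Series
  ι x zero    = x
  ι x (suc n) = 0#

  X : Series
  X 1 = 1#
  X _ = 0#

  ⋆-cong : ∀ {f f′ g g′} → f ≋ f′ → g ≋ g′ → f ⋆ g ≋ f′ ⋆ g′
  ⋆-cong f≋f′ g≋g′ n = ∑-cong n (λ a → *-cong (f≋f′ a) (g≋g′ (n ∸ a)))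

  ⋆-comm : ∀ f g → f ⋆ g ≋ g ⋆ f
  ⋆-comm f g n = trans (∑-reverse n _) (∑-cong-≤ n (λ a a≤n →
    trans (*-congˡ (reflexive (cong g (ℕ.m∸[m∸n]≡n a≤n)))) (*-comm _ _)))

  ⋆-assoc : ∀ f g h → (f ⋆ g) ⋆ h ≋ f ⋆ (g ⋆ h)
  ⋆-assoc f g h n = begin
    ∑ n (λ m → ∑ m (λ a → f a * g (m ∸ a)) * h (n ∸ m))
      ≈⟨ ∑-cong n (λ m → *-distribʳ-∑ m _ _) ⟩
    ∑ n (λ m → ∑ m (λ a → f a * g (m ∸ a) * h (n ∸ m)))
      ≈⟨ ∑-cong-≤ n (λ m m≤n → ∑-cong-≤ m (λ a a≤m →
           *-congˡ (reflexive (cong (λ k → h (n ∸ k)) (≡.sym (ℕ.m+[n∸m]≡n a≤m)))))) ⟩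
    ∑ n (λ m → ∑ m (λ a → F a (m ∸ a)))
      ≈⟨ ∑-triangle n F ⟨
    ∑ n (λ a → ∑ (n ∸ a) (F a))
      ≈⟨ ∑-cong n (λ a → ∑-cong (n ∸ a) (λ b →
           trans (*-assoc _ _ _) (*-congˡ (*-congˡ (reflexive (cong h (≡.sym (ℕ.∸-+-assoc n a b)))))))) ⟩
    ∑ n (λ a → ∑ (n ∸ a) (λ b → f a * (g b * h (n ∸ a ∸ b))))
      ≈⟨ ∑-cong n (λ a → *-distribˡ-∑ (n ∸ a) _ _) ⟨
    ∑ n (λ a → f a * ∑ (n ∸ a) (λ b → g b * h (n ∸ a ∸ b)))  ∎
    where
    F : ℕ → ℕ → Carrier
    F a b = f a * g b * h (n ∸ (a ℕ.+ b))

  ⋆-distribˡ : ∀ f g h → f ⋆ (λ n → g n + h n) ≋ λ n → (f ⋆ g) n + (f ⋆ h) n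
  ⋆-distribˡ f g h n = trans (∑-cong n (λ a → distribˡ _ _ _)) (∑-distrib-+ n _ _)

  ι-⋆ : ∀ x f → ι x ⋆ f ≋ λ n → x * f n
  ι-⋆ x f n = ∑-head n _ (λ a → zeroˡ _)

  X-⋆-zero : ∀ f → (X ⋆ f) 0 ≈ 0#
  X-⋆-zero f = zeroˡ _

  X-⋆-suc : ∀ f n → (X ⋆ f) (suc n) ≈ f n
  X-⋆-suc f n = begin
    ∑ (suc n) (λ a → X a * f (suc n ∸ a))              ≈⟨ ∑-suc n _ ⟩
    X 0 * f (suc n) + ∑ n (λ a → X (suc a) * f (n ∸ a)) ≈⟨ +-cong (zeroˡ _) (∑-head n _ (λ a → zeroˡ _)) ⟩
    0# + 1# * f n                                        ≈⟨ +-identityˡ _ ⟩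
    1# * f n                                             ≈⟨ *-identityˡ _ ⟩
    f n                                                  ∎

  convolutionRing : CommutativeRing c ℓ
  convolutionRing = record
    { isCommutativeRing = record
      { isRing = record
        { +-isAbelianGroup = Pointwise.isAbelianGroup ℕ +-isAbelianGroup
        ; *-cong = ⋆-cong
        ; *-assoc = ⋆-assoc
        ; *-identity = identityˡ , λ f → trans′ (⋆-comm f (ι 1#)) (identityˡ f)
        ; distrib = ⋆-distribˡ , λ h f g → trans′ (⋆-comm _ h) (trans′ (⋆-distribˡ h f g)
                                     (λ n → +-cong (⋆-comm h f n) (⋆-comm h g n)))
        }
      ; *-comm = ⋆-comm
      }
    }
    where
    identityˡ : ∀ f → ι 1# ⋆ f ≋ f
    identityˡ f n = trans (ι-⋆ 1# f n) (*-identityˡ _)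
    trans′ : ∀ {f g h} → f ≋ g → g ≋ h → f ≋ h
    trans′ f≋g g≋h n = trans (f≋g n) (g≋h n)

  ι-cong : ∀ {x y} → x ≈ y → ι x ≋ ι y
  ι-cong x≈y zero    = x≈y
  ι-cong x≈y (suc n) = refl

  ι-+ : ∀ x y → ι (x + y) ≋ λ n → ι x n + ι y n
  ι-+ x y zero    = refl
  ι-+ x y (suc n) = sym (+-identityˡ 0#)

  ι-* : ∀ x y → ι (x * y) ≋ ι x ⋆ ι y
  ι-* x y n = sym (trans (ι-⋆ x (ι y) n) (lemma n))
    where
    lemma : ∀ n → x * ι y n ≈ ι (x * y) n
    lemma zero    = refl
    lemma (suc n) = zeroʳ x

  ι-neg : ∀ x → ι (- x) ≋ λ n → - ι x n
  ι-neg x zero    = refl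
  ι-neg x (suc n) = sym -0#≈0#

  ι-0 : ι 0# ≋ λ _ → 0#
  ι-0 zero    = refl
  ι-0 (suc n) = refl

module TransferMultiplication {c ℓ} (R : CommutativeRing c ℓ) where
  open CommutativeRing R
  open import Algebra.Core using (Op₂)
  open import Algebra.Structures _≈_ using (IsCommutativeRing)
  open import Relation.Binary.Reasoning.Setoid setoid

  isCommutativeRing′ : (_*′_ : Op₂ Carrier) (1#′ : Carrier) →
    (∀ x y → x *′ y ≈ x * y) → 1#′ ≈ 1# → IsCommutativeRing _+_ _*′_ -_ 0# 1#′
  isCommutativeRing′ _*′_ 1#′ *′≈* 1#′≈1# = record
    { isRing = record
      { +-isAbelianGroup = +-isAbelianGroup
      ; *-cong = λ {x} {x′} {y} {y′} x≈x′ y≈y′ → begin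
          x *′ y    ≈⟨ *′≈* x y ⟩
          x * y     ≈⟨ *-cong x≈x′ y≈y′ ⟩
          x′ * y′   ≈⟨ *′≈* x′ y′ ⟨
          x′ *′ y′  ∎
      ; *-assoc = λ x y z → begin
          (x *′ y) *′ z  ≈⟨ trans (*′≈* _ z) (*-congʳ (*′≈* x y)) ⟩
          (x * y) * z    ≈⟨ *-assoc x y z ⟩
          x * (y * z)    ≈⟨ trans (*′≈* x _) (*-congˡ (*′≈* y z)) ⟨
          x *′ (y *′ z)  ∎
      ; *-identity = (λ x → trans (*′≈* 1#′ x) (trans (*-congʳ 1#′≈1#) (*-identityˡ x)))
                   , (λ x → trans (*′≈* x 1#′) (trans (*-congˡ 1#′≈1#) (*-identityʳ x)))
      ; distrib = (λ x y z → trans (*′≈* x _) (trans (distribˡ x y z)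
                               (sym (+-cong (*′≈* x y) (*′≈* x z)))))
                , (λ x y z → trans (*′≈* _ x) (trans (distribʳ x y z)
                               (sym (+-cong (*′≈* y x) (*′≈* z x)))))
      }
    ; *-comm = λ x y → trans (*′≈* x y) (trans (*-comm x y) (sym (*′≈* y x)))
    }

-- Power series in z and V

module SeriesV  = Convolution ℤ.+-*-commutativeRing
module SeriesZV = Convolution SeriesV.convolutionRing
open SeriesV using (∑)

open import Defs
open ≡ using (refl; sym; trans; cong₂; module ≡-Reasoning)

sumTo≡∑ : ∀ n f → sumTo n f ≡ ∑ n f
sumTo≡∑ zero    f = refl
sumTo≡∑ (suc n) f = cong (ℤ._+ f (suc n)) (sumTo≡∑ n f)

∑-pointwise : ∀ n F k → SeriesZV.∑ n F k ≡ ∑ n (λ a → F a k)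
∑-pointwise zero    F k = refl
∑-pointwise (suc n) F k = cong (ℤ._+ F (suc n) k) (∑-pointwise n F k)

⊗≈⋆ : ∀ f g → f ⊗ g ≈ f SeriesZV.⋆ g
⊗≈⋆ f g n k = begin
  sumTo n (λ a → sumTo k (λ b → f a b ℤ.* g (n ∸ a) (k ∸ b)))
    ≡⟨ sumTo≡∑ n _ ⟩
  ∑ n (λ a → sumTo k (λ b → f a b ℤ.* g (n ∸ a) (k ∸ b)))
    ≡⟨ SeriesV.∑-cong n (λ a → sumTo≡∑ k _) ⟩
  ∑ n (λ a → (f a SeriesV.⋆ g (n ∸ a)) k)
    ≡⟨ sym (∑-pointwise n _ k) ⟩
  (f SeriesZV.⋆ g) n k ∎
  where open ≡-Reasoning

const : ℤ → Ser
const x = SeriesZV.ι (SeriesV.ι x)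

one≈const1 : one ≈ const (+ 1)
one≈const1 zero    zero    = refl
one≈const1 zero    (suc k) = refl
one≈const1 (suc n) zero    = refl
one≈const1 (suc n) (suc k) = refl

serRing : CommutativeRing _ _
serRing = record
  { isCommutativeRing = TransferMultiplication.isCommutativeRing′ SeriesZV.convolutionRing
                          _⊗_ one ⊗≈⋆ one≈const1 }

serACR : AlmostCommutativeRing _ _
serACR = fromCommutativeRing serRing

open CommutativeRing serRing using (+-cong; *-cong; *-assoc; *-identityˡ; *-identityʳ; -‿cong)
  renaming (refl to ≈-refl; sym to ≈-sym; trans to ≈-trans)
module ≈-Reasoning = Relation.Binary.Reasoning.Setoid (CommutativeRing.setoid serRing)
open import Algebra.Properties.Semiring.Exp (AlmostCommutativeRing.semiring serACR) using (_^_)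

const-homomorphism : ℤ.+-*-rawRing -Raw-AlmostCommutative⟶ serACR
const-homomorphism = record
  { ⟦_⟧    = const
  ; +-homo = λ x y → ≈-trans (SeriesZV.ι-cong (SeriesV.ι-+ x y)) (SeriesZV.ι-+ (SeriesV.ι x) (SeriesV.ι y))
  ; *-homo = λ x y → ≈-trans (SeriesZV.ι-cong (SeriesV.ι-* x y))
                       (≈-trans (SeriesZV.ι-* (SeriesV.ι x) (SeriesV.ι y)) (≈-sym (⊗≈⋆ (const x) (const y))))
  ; -‿homo = λ x → ≈-trans (SeriesZV.ι-cong (SeriesV.ι-neg x)) (SeriesZV.ι-neg (SeriesV.ι x))
  ; 0-homo = ≈-trans (SeriesZV.ι-cong SeriesV.ι-0) SeriesZV.ι-0
  ; 1-homo = ≈-sym one≈const1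
  }

const-≟ : ∀ x y → Maybe (const x ≈ const y)
const-≟ x y with x ℤ.≟ y
... | yes refl = just ≈-refl
... | no _     = nothing

module Solver = Algebra.Solver.Ring ℤ.+-*-rawRing serACR const-homomorphism const-≟
open Solver using (solve; _:=_; _:+_; _:*_; _:-_; Polynomial; con; var; _:^_; ⟦_⟧; ⟦_⟧↓; prove)

zS≈X : zS ≈ SeriesZV.X
zS≈X zero          k       = refl
zS≈X 1             zero    = refl
zS≈X 1             (suc k) = refl
zS≈X (suc (suc n)) k       = refl

vS≈ιX : vS ≈ SeriesZV.ι SeriesV.X
vS≈ιX zero    zero          = refl
vS≈ιX zero    1             = refl
vS≈ιX zero    (suc (suc k)) = refl
vS≈ιX (suc n) k             = refl

⊗≈⋆-congˡ : ∀ {g g′} f → g ≈ g′ → g ⊗ f ≈ g′ SeriesZV.⋆ f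
⊗≈⋆-congˡ {g} {g′} f g≈g′ = ≈-trans (⊗≈⋆ g f) (SeriesZV.⋆-cong {g} {g′} {f} {f} g≈g′ (λ _ _ → refl))

zS⊗-zero : ∀ f k → (zS ⊗ f) 0 k ≡ + 0
zS⊗-zero f k = trans (⊗≈⋆-congˡ f zS≈X 0 k) (SeriesZV.X-⋆-zero f k)

zS⊗-suc : ∀ f n k → (zS ⊗ f) (suc n) k ≡ f n k
zS⊗-suc f n k = trans (⊗≈⋆-congˡ f zS≈X (suc n) k) (SeriesZV.X-⋆-suc f n k)

vS⊗-zero : ∀ f n → (vS ⊗ f) n 0 ≡ + 0
vS⊗-zero f n = trans (⊗≈⋆-congˡ f vS≈ιX n 0) (trans (SeriesZV.ι-⋆ SeriesV.X f n 0) (SeriesV.X-⋆-zero (f n)))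

vS⊗-suc : ∀ f n k → (vS ⊗ f) n (suc k) ≡ f n k
vS⊗-suc f n k = trans (⊗≈⋆-congˡ f vS≈ιX n (suc k)) (trans (SeriesZV.ι-⋆ SeriesV.X f n (suc k)) (SeriesV.X-⋆-suc (f n) k))

·≈const⊗ : ∀ m f → m · f ≈ const (+ m) ⊗ f
·≈const⊗ m f n k = sym (trans (⊗≈⋆ (const (+ m)) f n k)
  (trans (SeriesZV.ι-⋆ (SeriesV.ι (+ m)) f n k) (SeriesV.ι-⋆ (+ m) (f n) k)))

zp≈^ : ∀ a → zp a ≈ zS ^ a
zp≈^ zero    = ≈-refl
zp≈^ (suc a) = *-cong (≈-refl {zS}) (zp≈^ a)

-- Tails of Catalan words

module ∑ˢ = Sums serRing
open ∑ˢ using () renaming (∑ to ∑ˢ)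

∑ˢ-pointwise : ∀ j F n k → ∑ˢ j F n k ≡ ∑ j (λ b → F b n k)
∑ˢ-pointwise zero    F n k = refl
∑ˢ-pointwise (suc j) F n k = cong (ℤ._+ F (suc j) n k) (∑ˢ-pointwise j F n k)

markIf : Bool → (ℕ → ℤ) → ℕ → ℤ
markIf false h k       = h k
markIf true  h zero    = + 0
markIf true  h (suc k) = h k

markIf-cong : ∀ b {h h′ : ℕ → ℤ} → (∀ k → h k ≡ h′ k) → ∀ k → markIf b h k ≡ markIf b h′ k
markIf-cong false h≡h′ k       = h≡h′ k
markIf-cong true  h≡h′ zero    = refl
markIf-cong true  h≡h′ (suc k) = h≡h′ k

markIfˢ : Bool → Ser → Ser
markIfˢ b f n = markIf b (f n)

markIfˢ-true : ∀ f → markIfˢ true f ≈ vS ⊗ f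
markIfˢ-true f n zero    = sym (vS⊗-zero f n)
markIfˢ-true f n (suc k) = sym (vS⊗-suc f n k)

markIfˢ-⊗ : ∀ b f g → markIfˢ b f ⊗ g ≈ markIfˢ b (f ⊗ g)
markIfˢ-⊗ false f g = ≈-refl
markIfˢ-⊗ true  f g = begin
  markIfˢ true f ⊗ g  ≈⟨ *-cong (markIfˢ-true f) (≈-refl {g}) ⟩
  (vS ⊗ f) ⊗ g        ≈⟨ *-assoc vS f g ⟩
  vS ⊗ (f ⊗ g)        ≈⟨ markIfˢ-true (f ⊗ g) ⟨
  markIfˢ true (f ⊗ g) ∎
  where open ≈-Reasoning

-- T_i(j): the words w with steps j w, V marking the letter i.
tails : ℕ → ℕ → Ser
tails i j zero    zero    = + 1
tails i j zero    (suc k) = + 0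
tails i j (suc n) k       = ∑ j (λ b → markIf (suc b ≡ᵇ i) (tails i (suc b) n) k)

firstLetter : ℕ → ℕ → Ser
firstLetter i j = ∑ˢ j (λ b → markIfˢ (suc b ≡ᵇ i) (tails i (suc b)))

tails-unfold : ∀ i j → tails i j ≈ one ⊕ zS ⊗ firstLetter i j
tails-unfold i j zero    zero    = sym (cong (ℤ._+_ (+ 1)) (zS⊗-zero (firstLetter i j) 0))
tails-unfold i j zero    (suc k) = sym (cong (ℤ._+_ (+ 0)) (zS⊗-zero (firstLetter i j) (suc k)))
tails-unfold i j (suc n) k       = sym (trans (ℤ.+-identityˡ _)
  (trans (zS⊗-suc (firstLetter i j) n k) (∑ˢ-pointwise j _ n k)))

infix 4 _≈[≤_]_
_≈[≤_]_ : Ser → ℕ → Ser → Set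
f ≈[≤ N ] g = ∀ n → n ≤ N → ∀ k → f n k ≡ g n k

≈⇒≈[≤] : ∀ {f g N} → f ≈ g → f ≈[≤ N ] g
≈⇒≈[≤] f≈g n _ k = f≈g n k

≈[≤]-trans : ∀ {f g h N} → f ≈[≤ N ] g → g ≈[≤ N ] h → f ≈[≤ N ] h
≈[≤]-trans f≈g g≈h n n≤N k = trans (f≈g n n≤N k) (g≈h n n≤N k)

⊕-cong≤ : ∀ {f f′ g g′ N} → f ≈[≤ N ] f′ → g ≈[≤ N ] g′ → f ⊕ g ≈[≤ N ] f′ ⊕ g′
⊕-cong≤ f≈f′ g≈g′ n n≤N k = cong₂ ℤ._+_ (f≈f′ n n≤N k) (g≈g′ n n≤N k)

∑ˢ-cong≤ : ∀ {N} j {F G} → (∀ b → F b ≈[≤ N ] G b) → ∑ˢ j F ≈[≤ N ] ∑ˢ j G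
∑ˢ-cong≤ j F≈G n n≤N k = trans (∑ˢ-pointwise j _ n k)
  (trans (SeriesV.∑-cong j (λ b → F≈G b n n≤N k)) (sym (∑ˢ-pointwise j _ n k)))

markIfˢ-cong≤ : ∀ {N} b {f g} → f ≈[≤ N ] g → markIfˢ b f ≈[≤ N ] markIfˢ b g
markIfˢ-cong≤ false f≈g = f≈g
markIfˢ-cong≤ true  f≈g n n≤N zero    = refl
markIfˢ-cong≤ true  f≈g n n≤N (suc k) = f≈g n n≤N k

zS⊗-agree-0 : ∀ f g → zS ⊗ f ≈[≤ 0 ] zS ⊗ g
zS⊗-agree-0 f g zero z≤n k = trans (zS⊗-zero f k) (sym (zS⊗-zero g k))

zS⊗-cong≤ : ∀ {N f g} → f ≈[≤ N ] g → zS ⊗ f ≈[≤ suc N ] zS ⊗ g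
zS⊗-cong≤ {f = f} {g} f≈g zero    _         k = trans (zS⊗-zero f k) (sym (zS⊗-zero g k))
zS⊗-cong≤ {f = f} {g} f≈g (suc n) (s≤s n≤N) k = trans (zS⊗-suc f n k) (trans (f≈g n n≤N k) (sym (zS⊗-suc g n k)))

≈[≤]⇒≈ : ∀ {f g} → (∀ N → f ≈[≤ N ] g) → f ≈ g
≈[≤]⇒≈ f≈g n k = f≈g n n ℕ.≤-refl k

markIfˢ-pred : ∀ i b g → markIfˢ (suc b ≡ᵇ (i ∸ 1)) g ≈ markIfˢ (suc (suc b) ≡ᵇ i) g
markIfˢ-pred zero    b g = ≈-refl
markIfˢ-pred (suc i) b g = ≈-refl

-- A tail after j+1 splits before its first letter 1 into a tail after j shifted up by one and a
-- Catalan word. The proof is algebraic: both sides unfold in the same way, so they agree up to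
-- every degree in z.
tails-factor : ∀ i j → tails i (suc j) ≈ tails (i ∸ 1) j ⊗ tails i 0
tails-factor i j = ≈[≤]⇒≈ (λ N → agree N j)
  where
  open ≈-Reasoning
  a S₁ : Ser
  a  = tails i 0
  S₁ = markIfˢ (1 ≡ᵇ i) (tails i 1)

  U W : ℕ → Ser
  U j = ∑ˢ j (λ b → markIfˢ (suc (suc b) ≡ᵇ i) (tails i (suc (suc b))))
  W j = ∑ˢ j (λ b → markIfˢ (suc (suc b) ≡ᵇ i) (tails (i ∸ 1) (suc b) ⊗ a))

  lhs : ∀ j → tails i (suc j) ≈ one ⊕ zS ⊗ (S₁ ⊕ U j)
  lhs j = ≈-trans (tails-unfold i (suc j))
    (+-cong (≈-refl {one}) (*-cong (≈-refl {zS}) (∑ˢ.∑-suc j (λ b → markIfˢ (suc b ≡ᵇ i) (tails i (suc b))))))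

  rhs : ∀ j → tails (i ∸ 1) j ⊗ a ≈ one ⊕ zS ⊗ (S₁ ⊕ W j)
  rhs j = begin
    tails (i ∸ 1) j ⊗ a                           ≈⟨ *-cong (tails-unfold (i ∸ 1) j) (≈-refl {a}) ⟩
    (one ⊕ zS ⊗ F) ⊗ a                            ≈⟨ solve 4 (λ o z f x → (o :+ z :* f) :* x := o :* x :+ z :* (f :* x)) ≈-refl one zS F a ⟩
    one ⊗ a ⊕ zS ⊗ (F ⊗ a)                        ≈⟨ +-cong (≈-trans (*-identityˡ a) (tails-unfold i 0)) (≈-refl {zS ⊗ (F ⊗ a)}) ⟩
    (one ⊕ zS ⊗ S₁) ⊕ zS ⊗ (F ⊗ a)                ≈⟨ solve 4 (λ o z s t → (o :+ z :* s) :+ z :* t := o :+ z :* (s :+ t)) ≈-refl one zS S₁ (F ⊗ a) ⟩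
    one ⊕ zS ⊗ (S₁ ⊕ F ⊗ a)                       ≈⟨ +-cong (≈-refl {one}) (*-cong (≈-refl {zS}) (+-cong (≈-refl {S₁}) F⊗a≈W)) ⟩
    one ⊕ zS ⊗ (S₁ ⊕ W j)                         ∎
    where
    F = firstLetter (i ∸ 1) j
    F⊗a≈W : F ⊗ a ≈ W j
    F⊗a≈W = ≈-trans (∑ˢ.*-distribʳ-∑ j a _) (∑ˢ.∑-cong j (λ b →
      ≈-trans (markIfˢ-⊗ (suc b ≡ᵇ (i ∸ 1)) (tails (i ∸ 1) (suc b)) a) (markIfˢ-pred i b _)))

  agree : ∀ N j → tails i (suc j) ≈[≤ N ] tails (i ∸ 1) j ⊗ a
  agree N j = ≈[≤]-trans (≈⇒≈[≤] (lhs j))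
    (≈[≤]-trans (⊕-cong≤ (≈⇒≈[≤] (≈-refl {one})) (inner N)) (≈⇒≈[≤] (≈-sym (rhs j))))
    where
    inner : ∀ N → zS ⊗ (S₁ ⊕ U j) ≈[≤ N ] zS ⊗ (S₁ ⊕ W j)
    inner zero    = zS⊗-agree-0 (S₁ ⊕ U j) (S₁ ⊕ W j)
    inner (suc N) = zS⊗-cong≤ (⊕-cong≤ (≈⇒≈[≤] (≈-refl {S₁}))
      (∑ˢ-cong≤ j (λ b → markIfˢ-cong≤ (suc (suc b) ≡ᵇ i) (agree N (suc b)))))

-- Catalan and ballot numbers

pascal : ∀ m k → suc m C suc k ≡ m C k ℕ.+ m C suc k
pascal m k = sym (nCk+nC[k+1]≡[n+1]C[k+1] m k)

C-sym : ∀ k l → (k ℕ.+ l) C k ≡ (k ℕ.+ l) C l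
C-sym k l = trans (nCk≡nC[n∸k] (ℕ.m≤m+n k l)) (cong ((k ℕ.+ l) C_) (ℕ.m+n∸m≡n k l))

C-sym-at : ∀ {m} k l → m ≡ k ℕ.+ l → m C k ≡ m C l
C-sym-at k l refl = C-sym k l

C-absorb : ∀ m k → suc k ℕ.* (suc m C suc k) ≡ suc m ℕ.* (m C k)
C-absorb zero    zero    = refl
C-absorb zero    (suc k) rewrite k>n⇒nCk≡0 {1} {suc (suc k)} (s≤s (s≤s z≤n))
                               | k>n⇒nCk≡0 {0} {suc k} (s≤s z≤n) = ℕ.*-zeroʳ (suc (suc k))
C-absorb (suc m) zero    rewrite nC1≡n (suc (suc m)) = ℕ.*-comm 1 (suc (suc m))
C-absorb (suc m) (suc k) = begin
  suc (suc k) ℕ.* (suc (suc m) C suc (suc k))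
    ≡⟨ cong (suc (suc k) ℕ.*_) (pascal (suc m) (suc k)) ⟩
  suc (suc k) ℕ.* (suc m C suc k ℕ.+ suc m C suc (suc k))
    ≡⟨ ring₁ (suc m C suc k) (suc m C suc (suc k)) k ⟩
  suc m C suc k ℕ.+ suc k ℕ.* (suc m C suc k) ℕ.+ suc (suc k) ℕ.* (suc m C suc (suc k))
    ≡⟨ cong₂ (λ x y → suc m C suc k ℕ.+ x ℕ.+ y) (C-absorb m k) (C-absorb m (suc k)) ⟩
  suc m C suc k ℕ.+ suc m ℕ.* (m C k) ℕ.+ suc m ℕ.* (m C suc k)
    ≡⟨ cong (λ x → x ℕ.+ suc m ℕ.* (m C k) ℕ.+ suc m ℕ.* (m C suc k)) (pascal m k) ⟩
  m C k ℕ.+ m C suc k ℕ.+ suc m ℕ.* (m C k) ℕ.+ suc m ℕ.* (m C suc k)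
    ≡⟨ ring₂ (m C k) (m C suc k) m ⟩
  suc (suc m) ℕ.* (m C k ℕ.+ m C suc k)
    ≡⟨ cong (suc (suc m) ℕ.*_) (pascal m k) ⟨
  suc (suc m) ℕ.* (suc m C suc k) ∎
  where
  open ≡-Reasoning
  ring₁ : ∀ a b k → suc (suc k) ℕ.* (a ℕ.+ b) ≡ a ℕ.+ suc k ℕ.* a ℕ.+ suc (suc k) ℕ.* b
  ring₁ = ℕ-Solver.solve-∀
  ring₂ : ∀ p q m → p ℕ.+ q ℕ.+ suc m ℕ.* p ℕ.+ suc m ℕ.* q ≡ suc (suc m) ℕ.* (p ℕ.+ q)
  ring₂ = ℕ-Solver.solve-∀

twice+ : ℕ → ℕ → ℕ
twice+ zero    j = j
twice+ (suc n) j = suc (suc (twice+ n j))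

twice+-suc : ∀ n j → twice+ n (suc j) ≡ suc (twice+ n j)
twice+-suc zero    j = refl
twice+-suc (suc n) j = cong (λ m → suc (suc m)) (twice+-suc n j)

twice+-2+ : ∀ n j → twice+ n (suc (suc j)) ≡ twice+ (suc n) j
twice+-2+ zero    j = refl
twice+-2+ (suc n) j = cong (λ m → suc (suc m)) (twice+-2+ n j)

twice+≡ : ∀ n j → twice+ n j ≡ n ℕ.+ (n ℕ.+ j)
twice+≡ zero    j = refl
twice+≡ (suc n) j = cong suc (trans (cong suc (twice+≡ n j)) (sym (ℕ.+-suc n (n ℕ.+ j))))

2n+3≡ : ∀ n → suc (suc (suc (twice+ n 0))) ≡ suc (suc n) ℕ.+ suc n
2n+3≡ n = trans (cong (λ m → 3 ℕ.+ m) (twice+≡ n 0)) (ring n)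
  where
  ring : ∀ n → 3 ℕ.+ (n ℕ.+ (n ℕ.+ 0)) ≡ suc (suc n) ℕ.+ suc n
  ring = ℕ-Solver.solve-∀

-- ballot j n = C(2n+j, n) - C(2n+j, n-1) for n > 0: the number of tails of length n after the letter j
ballot : ℕ → ℕ → ℤ
ballot j zero    = + 1
ballot j (suc n) = + (twice+ (suc n) j C suc n) ℤ.- + (twice+ (suc n) j C n)

ballot-step : ∀ j n → ballot j (suc n) ℤ.+ ballot (suc (suc j)) n ≡ ballot (suc j) (suc n)
ballot-step j zero rewrite nC1≡n (suc (suc j)) | nC1≡n (suc (suc (suc j))) = lemma (+ j)
  where
  lemma : ∀ x → (+ 2 ℤ.+ x) ℤ.- + 1 ℤ.+ + 1 ≡ (+ 3 ℤ.+ x) ℤ.- + 1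
  lemma = ℤ-Solver.solve-∀
ballot-step j (suc n) rewrite twice+-2+ n j | twice+-suc n j
  | pascal (suc (suc (suc (suc (twice+ n j))))) (suc n) | pascal (suc (suc (suc (suc (twice+ n j))))) n
  = lemma (T C n) (T C suc n) (T C suc (suc n))
  where
  T = suc (suc (suc (suc (twice+ n j))))
  lemma : ∀ a b c → + c ℤ.- + b ℤ.+ (+ b ℤ.- + a) ≡ + (b ℕ.+ c) ℤ.- + (a ℕ.+ b)
  lemma a b c rewrite ℤ.pos-+ b c | ℤ.pos-+ a b = ring (+ a) (+ b) (+ c)
    where
    ring : ∀ x y z → z ℤ.- y ℤ.+ (y ℤ.- x) ≡ y ℤ.+ z ℤ.- (x ℤ.+ y)
    ring = ℤ-Solver.solve-∀

ballot-first : ∀ n → ballot 1 n ≡ ballot 0 (suc n)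
ballot-first zero    = refl
ballot-first (suc n) rewrite twice+-suc n 0
  | pascal (suc (suc (suc (twice+ n 0)))) (suc n) | pascal (suc (suc (suc (twice+ n 0)))) n
  | C-sym-at {suc (suc (suc (twice+ n 0)))} (suc (suc n)) (suc n) (2n+3≡ n)
  = lemma (U C n) (U C suc n)
  where
  U = suc (suc (suc (twice+ n 0)))
  lemma : ∀ a b → + b ℤ.- + a ≡ + (b ℕ.+ b) ℤ.- + (a ℕ.+ b)
  lemma a b rewrite ℤ.pos-+ b b | ℤ.pos-+ a b = ring (+ a) (+ b)
    where
    ring : ∀ x y → y ℤ.- x ≡ y ℤ.+ y ℤ.- (x ℤ.+ y)
    ring = ℤ-Solver.solve-∀

∑-ballot : ∀ j n → ∑ j (λ b → ballot (suc b) n) ≡ ballot j (suc n)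
∑-ballot zero    n = ballot-first n
∑-ballot (suc j) n = trans (cong (ℤ._+ ballot (suc (suc j)) n) (∑-ballot j n)) (ballot-step j n)

-- With i = 0 no letter is marked, so tails 0 j counts all tails after j.
tails0-unmarked : ∀ j n → tails 0 j n 0 ≡ ballot j n
tails0-unmarked j zero    = refl
tails0-unmarked j (suc n) = trans (SeriesV.∑-cong j (λ b → tails0-unmarked (suc b) n)) (∑-ballot j n)

tails0-marked : ∀ j n k → tails 0 j n (suc k) ≡ + 0
tails0-marked j zero    k = refl
tails0-marked j (suc n) k =
  trans (SeriesV.∑-cong j (λ b → tails0-marked (suc b) n k)) (SeriesV.∑-head j _ (λ _ → refl))

catalan-relation : ∀ n → suc (suc n) ℕ.* (twice+ (suc n) 0 C n) ≡ suc n ℕ.* (twice+ (suc n) 0 C suc n)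
catalan-relation n = begin
  suc (suc n) ℕ.* (D C n)         ≡⟨ cong (suc (suc n) ℕ.*_) (C-sym-at n (suc (suc n)) D≡) ⟩
  suc (suc n) ℕ.* (D C suc (suc n)) ≡⟨ C-absorb D′ (suc n) ⟩
  D ℕ.* (D′ C suc n)              ≡⟨ cong (D ℕ.*_) (C-sym-at (suc n) n D′≡) ⟩
  D ℕ.* (D′ C n)                  ≡⟨ C-absorb D′ n ⟨
  suc n ℕ.* (D C suc n)           ∎
  where
  open ≡-Reasoning
  D′ = suc (twice+ n 0)
  D  = suc D′
  D′≡ : D′ ≡ suc n ℕ.+ n
  D′≡ = trans (cong suc (twice+≡ n 0)) (cong suc (cong (n ℕ.+_) (ℕ.+-identityʳ n)))
  D≡ : D ≡ n ℕ.+ suc (suc n)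
  D≡ = trans (cong suc D′≡) (trans (cong suc (ℕ.+-comm (suc n) n)) (sym (ℕ.+-suc n (suc n))))

-- If (m+1) y = m x then x = (m+1)(x - y), so the division below is exact.
/-exact : ∀ m x y → suc m ℕ.* y ≡ m ℕ.* x → y ≤ x × x / suc m ≡ x ∸ y
/-exact m x y eq = y≤x , trans (cong (_/ suc m) (sym x≡)) (m*n/n≡m (x ∸ y) (suc m))
  where
  open ≡-Reasoning
  y≤x : y ≤ x
  y≤x = ℕ.*-cancelˡ-≤ (suc m) (ℕ.≤-trans (ℕ.≤-reflexive eq) (ℕ.*-monoˡ-≤ x (ℕ.n≤1+n m)))
  x≡ : (x ∸ y) ℕ.* suc m ≡ x
  x≡ = begin
    (x ∸ y) ℕ.* suc m                ≡⟨ ℕ.*-distribʳ-∸ (suc m) x y ⟩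
    x ℕ.* suc m ∸ y ℕ.* suc m        ≡⟨ cong₂ _∸_ (ℕ.*-comm x (suc m)) (ℕ.*-comm y (suc m)) ⟩
    x ℕ.+ m ℕ.* x ∸ suc m ℕ.* y      ≡⟨ cong (x ℕ.+ m ℕ.* x ∸_) eq ⟩
    x ℕ.+ m ℕ.* x ∸ m ℕ.* x          ≡⟨ ℕ.m+n∸n≡m x (m ℕ.* x) ⟩
    x                                ∎

catalan : ∀ n → cS n 0 ≡ ballot 0 n
catalan zero    = refl
catalan (suc n) = begin
  + (((2 ℕ.* suc n) C suc n) / suc (suc n)) ≡⟨ cong (λ m → + ((m C suc n) / suc (suc n))) (sym (twice+≡ (suc n) 0)) ⟩
  + (x / suc (suc n))                    ≡⟨ cong +_ (proj₂ exact) ⟩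
  + (x ∸ y)                              ≡⟨ ℤ.⊖-≥ (proj₁ exact) ⟨
  x ℤ.⊖ y                                ≡⟨ ℤ.[+m]-[+n]≡m⊖n x y ⟨
  + x ℤ.- + y                            ∎
  where
  open ≡-Reasoning
  x = twice+ (suc n) 0 C suc n
  y = twice+ (suc n) 0 C n
  exact = /-exact (suc n) x y (catalan-relation n)

cS≈tails00 : cS ≈ tails 0 0
cS≈tails00 n zero    = trans (catalan n) (sym (tails0-unmarked 0 n))
cS≈tails00 n (suc k) = sym (tails0-marked 0 n k)

-- Counting words

sumN : ℕ → (ℕ → ℕ) → ℕ
sumN zero    F = 0
sumN (suc m) F = F 0 ℕ.+ sumN m (λ a → F (suc a))

sumN-cong : ∀ m {F G} → (∀ a → F a ≡ G a) → sumN m F ≡ sumN m G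
sumN-cong zero    F≡G = refl
sumN-cong (suc m) F≡G = cong₂ ℕ._+_ (F≡G 0) (sumN-cong m (λ a → F≡G (suc a)))

sumN-zero : ∀ m → sumN m (λ _ → 0) ≡ 0
sumN-zero zero    = refl
sumN-zero (suc m) = sumN-zero m

sumN-distrib-+ : ∀ m F G → sumN m (λ a → F a ℕ.+ G a) ≡ sumN m F ℕ.+ sumN m G
sumN-distrib-+ zero    F G = refl
sumN-distrib-+ (suc m) F G = trans (cong (F 0 ℕ.+ G 0 ℕ.+_) (sumN-distrib-+ m _ _))
  (ring (F 0) (G 0) (sumN m (λ a → F (suc a))) (sumN m (λ a → G (suc a))))
  where
  ring : ∀ a b c d → a ℕ.+ b ℕ.+ (c ℕ.+ d) ≡ a ℕ.+ c ℕ.+ (b ℕ.+ d)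
  ring = ℕ-Solver.solve-∀

sumN-truncate : ∀ t m Y → t ≤ m → sumN m (λ a → if a <ᵇ t then Y a else 0) ≡ sumN t Y
sumN-truncate zero    m       Y _         = sumN-zero m
sumN-truncate (suc t) (suc m) Y (s≤s t≤m) = cong (Y 0 ℕ.+_) (sumN-truncate t m (λ a → Y (suc a)) t≤m)

+sumN≡∑ : ∀ j Y → + sumN (suc j) Y ≡ ∑ j (λ b → + Y b)
+sumN≡∑ zero    Y = cong +_ (ℕ.+-identityʳ (Y 0))
+sumN≡∑ (suc j) Y = trans (ℤ.pos-+ (Y 0) _)
  (trans (cong (ℤ._+_ (+ Y 0)) (+sumN≡∑ j (λ a → Y (suc a)))) (sym (SeriesV.∑-suc j (λ b → + Y b))))

indicator : Bool → ℕ
indicator true  = 1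
indicator false = 0

module _ {A : Set} where

  countIf-∷ : ∀ (p : A → Bool) x xs → countIf p (x ∷ xs) ≡ indicator (p x) ℕ.+ countIf p xs
  countIf-∷ p x xs with p x
  ... | true  = refl
  ... | false = refl

  countIf-++ : ∀ (p : A → Bool) xs ys → countIf p (xs ++ ys) ≡ countIf p xs ℕ.+ countIf p ys
  countIf-++ p []       ys = refl
  countIf-++ p (x ∷ xs) ys = trans (countIf-∷ p x (xs ++ ys))
    (trans (cong (indicator (p x) ℕ.+_) (countIf-++ p xs ys))
      (trans (sym (ℕ.+-assoc (indicator (p x)) _ _)) (cong (ℕ._+ countIf p ys) (sym (countIf-∷ p x xs)))))

  countIf-cong : ∀ (xs : List A) {p p′ : A → Bool} → (∀ x → p x ≡ p′ x) → countIf p xs ≡ countIf p′ xs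
  countIf-cong []       p≡p′ = refl
  countIf-cong (x ∷ xs) p≡p′ = trans (countIf-∷ _ x xs)
    (trans (cong₂ ℕ._+_ (cong indicator (p≡p′ x)) (countIf-cong xs p≡p′)) (sym (countIf-∷ _ x xs)))

  countIf-false : ∀ (xs : List A) → countIf (λ _ → false) xs ≡ 0
  countIf-false []       = refl
  countIf-false (x ∷ xs) = countIf-false xs

  countIf-applyUpTo : ∀ (p : A → Bool) h m → countIf p (applyUpTo h m) ≡ sumN m (λ a → indicator (p (h a)))
  countIf-applyUpTo p h zero    = refl
  countIf-applyUpTo p h (suc m) = trans (countIf-∷ p (h 0) (applyUpTo (λ a → h (suc a)) m)) (cong (indicator (p (h 0)) ℕ.+_)
    (countIf-applyUpTo p (λ a → h (suc a)) m))

countIf-prepend : ∀ m (p : List ℕ → Bool) (W : List (List ℕ)) →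
  countIf p (concatMap (λ w → map (λ a → a ∷ w) (map suc (upTo m))) W)
    ≡ sumN m (λ b → countIf (λ w → p (suc b ∷ w)) W)
countIf-prepend m p []      = sym (sumN-zero m)
countIf-prepend m p (w ∷ W) = begin
  countIf p (map (λ a → a ∷ w) (map suc (upTo m)) ++ rest)
    ≡⟨ countIf-++ p (map (λ a → a ∷ w) (map suc (upTo m))) rest ⟩
  countIf p (map (λ a → a ∷ w) (map suc (upTo m))) ℕ.+ countIf p rest
    ≡⟨ cong₂ ℕ._+_ (trans (cong (countIf p) (trans (sym (List.map-∘ (upTo m))) (List.map-applyUpTo id _ m)))
                         (countIf-applyUpTo p _ m))
                  (countIf-prepend m p W) ⟩
  sumN m (λ b → indicator (p (suc b ∷ w))) ℕ.+ sumN m (λ b → countIf (λ w → p (suc b ∷ w)) W)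
    ≡⟨ sumN-distrib-+ m _ _ ⟨
  sumN m (λ b → indicator (p (suc b ∷ w)) ℕ.+ countIf (λ w → p (suc b ∷ w)) W)
    ≡⟨ sumN-cong m (λ b → sym (countIf-∷ (λ w → p (suc b ∷ w)) w W)) ⟩
  sumN m (λ b → countIf (λ w → p (suc b ∷ w)) (w ∷ W)) ∎
  where
  open ≡-Reasoning
  rest = concatMap (λ w → map (λ a → a ∷ w) (map suc (upTo m))) W

occ-prepend : ∀ i s (q : List ℕ → Bool) (W : List (List ℕ)) k →
  + countIf (λ w → q w ∧ (occ i (s ∷ w) ≡ᵇ k)) W
    ≡ markIf (s ≡ᵇ i) (λ k′ → + countIf (λ w → q w ∧ (occ i w ≡ᵇ k′)) W) k
occ-prepend i s q W k with s ≡ᵇ i | k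
... | false | _     = refl
... | true  | suc _ = refl
... | true  | zero  = cong +_ (trans (countIf-cong W (λ w → ∧-false (q w))) (countIf-false W))
  where
  ∧-false : ∀ b → (b ∧ false) ≡ false
  ∧-false true  = refl
  ∧-false false = refl

count : ℕ → ℕ → ℕ → ℕ → ℕ → ℕ
count i m j n k = countIf (λ w → steps j w ∧ (occ i w ≡ᵇ k)) (wordsOver m n)

-- The alphabet {1, …, m} is large enough as long as j + n ≤ m.
count≡tails : ∀ i n m j k → j ℕ.+ n ≤ m → + count i m j n k ≡ tails i j n k
count≡tails i zero    m j zero    _ = refl
count≡tails i zero    m j (suc k) _ = refl
count≡tails i (suc n) m j k j+n≤m = begin
  + count i m j (suc n) k
    ≡⟨ cong +_ (trans (countIf-prepend m _ (wordsOver m n)) (sumN-cong m filter)) ⟩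
  + sumN m (λ b → if b <ᵇ suc j then Y b else 0)
    ≡⟨ cong +_ (sumN-truncate (suc j) m Y j<m) ⟩
  + sumN (suc j) Y
    ≡⟨ +sumN≡∑ j Y ⟩
  ∑ j (λ b → + Y b)
    ≡⟨ SeriesV.∑-cong-≤ j (λ b b≤j → trans (occ-prepend i (suc b) (steps (suc b)) (wordsOver m n) k)
         (markIf-cong (suc b ≡ᵇ i) (λ k′ → count≡tails i n m (suc b) k′ (b+1+n≤m b≤j)) k)) ⟩
  tails i j (suc n) k ∎
  where
  open ≡-Reasoning
  Y : ℕ → ℕ
  Y b = countIf (λ w → steps (suc b) w ∧ (occ i (suc b ∷ w) ≡ᵇ k)) (wordsOver m n)
  filter : ∀ b → countIf (λ w → steps j (suc b ∷ w) ∧ (occ i (suc b ∷ w) ≡ᵇ k)) (wordsOver m n)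
               ≡ (if b <ᵇ suc j then Y b else 0)
  filter b with b <ᵇ suc j
  ... | true  = refl
  ... | false = countIf-false (wordsOver m n)
  j<m : suc j ≤ m
  j<m = ℕ.≤-trans (ℕ.m≤m+n (suc j) n) (ℕ.≤-trans (ℕ.≤-reflexive (sym (ℕ.+-suc j n))) j+n≤m)
  b+1+n≤m : ∀ {b} → b ≤ j → suc b ℕ.+ n ≤ m
  b+1+n≤m b≤j = ℕ.≤-trans (ℕ.+-monoˡ-≤ n (s≤s b≤j)) (ℕ.≤-trans (ℕ.≤-reflexive (sym (ℕ.+-suc j n))) j+n≤m)

isCatalan≡steps0 : ∀ w → isCatalan w ≡ steps 0 w
isCatalan≡steps0 []                = refl
isCatalan≡steps0 (zero ∷ w)        = refl
isCatalan≡steps0 (1 ∷ w)           = refl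
isCatalan≡steps0 (suc (suc a) ∷ w) = refl

A≈tails : ∀ i → A i ≈ tails i 0
A≈tails i n k = trans
  (cong +_ (countIf-cong (wordsOver n n) (λ w → cong (_∧ (occ i w ≡ᵇ k)) (isCatalan≡steps0 w))))
  (count≡tails i n n 0 k ℕ.≤-refl)

-- The continued fraction

tails₁-unfold : tails 1 0 ≈ one ⊕ zS ⊗ ((vS ⊗ cS) ⊗ tails 1 0)
tails₁-unfold = ≈-trans (tails-unfold 1 0) (+-cong (≈-refl {one}) (*-cong (≈-refl {zS}) (begin
  markIfˢ true (tails 1 1)        ≈⟨ markIfˢ-true (tails 1 1) ⟩
  vS ⊗ tails 1 1                  ≈⟨ *-cong (≈-refl {vS}) (tails-factor 1 0) ⟩
  vS ⊗ (tails 0 0 ⊗ tails 1 0)    ≈⟨ *-cong (≈-refl {vS}) (*-cong (≈-sym cS≈tails00) (≈-refl {tails 1 0})) ⟩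
  vS ⊗ (cS ⊗ tails 1 0)           ≈⟨ *-assoc vS cS (tails 1 0) ⟨
  (vS ⊗ cS) ⊗ tails 1 0           ∎)))
  where open ≈-Reasoning

tails₂₊-unfold : ∀ i → tails (suc (suc i)) 0 ≈ one ⊕ zS ⊗ (tails (suc i) 0 ⊗ tails (suc (suc i)) 0)
tails₂₊-unfold i = ≈-trans (tails-unfold (suc (suc i)) 0)
  (+-cong (≈-refl {one}) (*-cong (≈-refl {zS}) (tails-factor (suc (suc i)) 0)))

-- From a = 1 + z b a and b q = r: a (q - z r) = (a - z b a) q = q.
continued-step : ∀ {a b q r} → a ≈ one ⊕ zS ⊗ (b ⊗ a) → b ⊗ q ≈ r → a ⊗ (q ⊖ zS ⊗ r) ≈ q
continued-step {a} {b} {q} {r} a≈ bq≈r = begin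
  a ⊗ (q ⊖ zS ⊗ r)
    ≈⟨ *-cong (≈-refl {a}) (+-cong (≈-refl {q}) (-‿cong (*-cong (≈-refl {zS}) (≈-sym bq≈r)))) ⟩
  a ⊗ (q ⊖ zS ⊗ (b ⊗ q))
    ≈⟨ solve 4 (λ a b q z → a :* (q :- z :* (b :* q)) := (a :- z :* (b :* a)) :* q) ≈-refl a b q zS ⟩
  (a ⊖ zS ⊗ (b ⊗ a)) ⊗ q
    ≈⟨ *-cong (+-cong a≈ (-‿cong (≈-refl {zS ⊗ (b ⊗ a)}))) (≈-refl {q}) ⟩
  (one ⊕ zS ⊗ (b ⊗ a) ⊖ zS ⊗ (b ⊗ a)) ⊗ q
    ≈⟨ solve 3 (λ o x q → (o :+ x :- x) :* q := o :* q) ≈-refl one (zS ⊗ (b ⊗ a)) q ⟩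
  one ⊗ q
    ≈⟨ *-identityˡ q ⟩
  q ∎
  where open ≈-Reasoning

-- P j is ⟦ e ⟧ᵗ for the term e spelled like its definition, so P j ≈ ⟦ Q j ⟧ᵗ reduces to comparing
-- normal forms of polynomials in z, V and C.
infixl 6 _`⊕_ _`⊖_
infixr 8 _`·_
infixr 9 `zS⊗_

data Term : Set where
  `one         : Term
  `zp `zVC     : ℕ → Term
  _`⊕_ _`⊖_    : Term → Term → Term
  _`·_         : ℕ → Term → Term
  `zS⊗_        : Term → Term

⟦_⟧ᵗ : Term → Ser
⟦ `one ⟧ᵗ    = one
⟦ `zp a ⟧ᵗ   = zp a
⟦ `zVC a ⟧ᵗ  = zVC a
⟦ e `⊕ e′ ⟧ᵗ = ⟦ e ⟧ᵗ ⊕ ⟦ e′ ⟧ᵗ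
⟦ e `⊖ e′ ⟧ᵗ = ⟦ e ⟧ᵗ ⊖ ⟦ e′ ⟧ᵗ
⟦ m `· e ⟧ᵗ  = m · ⟦ e ⟧ᵗ
⟦ `zS⊗ e ⟧ᵗ  = zS ⊗ ⟦ e ⟧ᵗ

polynomial : Term → Polynomial 3
polynomial `one       = con (+ 1)
polynomial (`zp a)    = var zero :^ a
polynomial (`zVC a)   = var zero :^ a :* var (suc zero) :* var (suc (suc zero))
polynomial (e `⊕ e′)  = polynomial e :+ polynomial e′
polynomial (e `⊖ e′)  = polynomial e :- polynomial e′
polynomial (m `· e)   = con (+ m) :* polynomial e
polynomial (`zS⊗ e)   = var zero :* polynomial e

ρ : Vec Ser 3
ρ = zS ∷ vS ∷ cS ∷ []

⟦polynomial⟧ : ∀ e → ⟦ e ⟧ᵗ ≈ ⟦ polynomial e ⟧ ρ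
⟦polynomial⟧ `one      = one≈const1
⟦polynomial⟧ (`zp a)   = zp≈^ a
⟦polynomial⟧ (`zVC a)  = *-cong (*-cong (zp≈^ a) (≈-refl {vS})) (≈-refl {cS})
⟦polynomial⟧ (e `⊕ e′) = +-cong (⟦polynomial⟧ e) (⟦polynomial⟧ e′)
⟦polynomial⟧ (e `⊖ e′) = +-cong (⟦polynomial⟧ e) (-‿cong (⟦polynomial⟧ e′))
⟦polynomial⟧ (m `· e)  = ≈-trans (·≈const⊗ m ⟦ e ⟧ᵗ) (*-cong (≈-refl {const (+ m)}) (⟦polynomial⟧ e))
⟦polynomial⟧ (`zS⊗ e)  = *-cong (≈-refl {zS}) (⟦polynomial⟧ e)

SameNormalForm : Term → Term → Set
SameNormalForm e e′ = ⟦ polynomial e ⟧↓ ρ ≈ ⟦ polynomial e′ ⟧↓ ρ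

≈-by-normalForm : ∀ e e′ → SameNormalForm e e′ → ⟦ e ⟧ᵗ ≈ ⟦ e′ ⟧ᵗ
≈-by-normalForm e e′ nf = ≈-trans (⟦polynomial⟧ e)
  (≈-trans (prove ρ (polynomial e) (polynomial e′) nf) (≈-sym (⟦polynomial⟧ e′)))

Q : ℕ → Term
Q 0             = `one
Q 1             = `one `⊖ `zVC 1
Q (suc (suc j)) = Q (suc j) `⊖ `zS⊗ Q j

tails-continued : ∀ j → tails (suc j) 0 ⊗ ⟦ Q (suc j) ⟧ᵗ ≈ ⟦ Q j ⟧ᵗ
tails-continued zero    = ≈-trans (*-cong (≈-refl {tails 1 0}) Q₁≈)
  (continued-step {b = vS ⊗ cS} {q = one} tails₁-unfold (*-identityʳ (vS ⊗ cS)))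
  where
  Q₁≈ : ⟦ Q 1 ⟧ᵗ ≈ one ⊖ zS ⊗ (vS ⊗ cS)
  Q₁≈ = +-cong (≈-refl {one}) (-‿cong (≈-trans
    (*-cong (*-cong (*-identityʳ zS) (≈-refl {vS})) (≈-refl {cS})) (*-assoc zS vS cS)))
tails-continued (suc j) = continued-step {tails (suc (suc j)) 0} {tails (suc j) 0} {⟦ Q (suc j) ⟧ᵗ} {⟦ Q j ⟧ᵗ}
  (tails₂₊-unfold j) (tails-continued j)

A-ratio : ∀ j {P P′} → P ≈ ⟦ Q (suc j) ⟧ᵗ → P′ ≈ ⟦ Q j ⟧ᵗ → A (suc j) ⊗ P ≈ P′
A-ratio j {P} {P′} P≈Q P′≈Q = begin
  A (suc j) ⊗ P                       ≈⟨ *-cong (A≈tails (suc j)) P≈Q ⟩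
  tails (suc j) 0 ⊗ ⟦ Q (suc j) ⟧ᵗ     ≈⟨ tails-continued j ⟩
  ⟦ Q j ⟧ᵗ                             ≈⟨ P′≈Q ⟨
  P′                                   ∎
  where open ≈-Reasoning

P2≈Q : P2 ≈ ⟦ Q 2 ⟧ᵗ
P2≈Q = ≈-by-normalForm (`one `⊖ `zVC 1 `⊖ `zp 1) (Q 2) ≈-refl

P3≈Q : P3 ≈ ⟦ Q 3 ⟧ᵗ
P3≈Q = ≈-by-normalForm (`one `⊖ `zVC 1 `⊖ 2 `· `zp 1 `⊕ `zVC 2) (Q 3) ≈-refl

P4≈Q : P4 ≈ ⟦ Q 4 ⟧ᵗ
P4≈Q = ≈-by-normalForm (`one `⊖ `zVC 1 `⊖ 3 `· `zp 1 `⊕ 2 `· `zVC 2 `⊕ `zp 2) (Q 4) ≈-refl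

P5≈Q : P5 ≈ ⟦ Q 5 ⟧ᵗ
P5≈Q = ≈-by-normalForm (`one `⊖ `zVC 1 `⊖ 4 `· `zp 1 `⊕ 3 `· `zVC 2 `⊕ 3 `· `zp 2 `⊖ `zVC 3) (Q 5) ≈-refl

P6≈Q : P6 ≈ ⟦ Q 6 ⟧ᵗ
P6≈Q = ≈-by-normalForm
  (`one `⊖ `zVC 1 `⊖ 5 `· `zp 1 `⊕ 4 `· `zVC 2 `⊕ 6 `· `zp 2 `⊖ 3 `· `zVC 3 `⊖ `zp 3) (Q 6) ≈-refl

P7≈Q : P7 ≈ ⟦ Q 7 ⟧ᵗ
P7≈Q = ≈-by-normalForm
  (`one `⊖ `zVC 1 `⊖ 6 `· `zp 1 `⊕ 5 `· `zVC 2 `⊕ 10 `· `zp 2 `⊖ 6 `· `zVC 3 `⊖ 4 `· `zp 3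
     `⊕ `zVC 4) (Q 7) ≈-refl

P8≈Q : P8 ≈ ⟦ Q 8 ⟧ᵗ
P8≈Q = ≈-by-normalForm
  (`one `⊖ `zVC 1 `⊖ 7 `· `zp 1 `⊕ 6 `· `zVC 2 `⊕ 15 `· `zp 2 `⊖ 10 `· `zVC 3 `⊖ 10 `· `zp 3
     `⊕ 4 `· `zVC 4 `⊕ `zp 4) (Q 8) ≈-refl

P9≈Q : P9 ≈ ⟦ Q 9 ⟧ᵗ
P9≈Q = ≈-by-normalForm
  (`one `⊖ `zVC 1 `⊖ 8 `· `zp 1 `⊕ 7 `· `zVC 2 `⊕ 21 `· `zp 2 `⊖ 15 `· `zVC 3 `⊖ 20 `· `zp 3
     `⊕ 10 `· `zVC 4 `⊕ 5 `· `zp 4 `⊖ `zVC 5) (Q 9) ≈-refl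

P10≈Q : P10 ≈ ⟦ Q 10 ⟧ᵗ
P10≈Q = ≈-by-normalForm
  (`one `⊖ `zVC 1 `⊖ 9 `· `zp 1 `⊕ 8 `· `zVC 2 `⊕ 28 `· `zp 2 `⊖ 21 `· `zVC 3 `⊖ 35 `· `zp 3
     `⊕ 20 `· `zVC 4 `⊕ 15 `· `zp 4 `⊖ 5 `· `zVC 5 `⊖ `zp 5) (Q 10) ≈-refl

mainTheorem3 : (A 1 ⊗ P1 ≈ P0) × (A 2 ⊗ P2 ≈ P1) × (A 3 ⊗ P3 ≈ P2)
    × (A 4 ⊗ P4 ≈ P3) × (A 5 ⊗ P5 ≈ P4) × (A 6 ⊗ P6 ≈ P5)
    × (A 7 ⊗ P7 ≈ P6) × (A 8 ⊗ P8 ≈ P7) × (A 9 ⊗ P9 ≈ P8)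
    × (A 10 ⊗ P10 ≈ P9)
mainTheorem3 =
    A-ratio 0 ≈-refl ≈-refl
  , A-ratio 1 P2≈Q ≈-refl
  , A-ratio 2 P3≈Q P2≈Q
  , A-ratio 3 P4≈Q P3≈Q
  , A-ratio 4 P5≈Q P4≈Q
  , A-ratio 5 P6≈Q P5≈Q
  , A-ratio 6 P7≈Q P6≈Q
  , A-ratio 7 P8≈Q P7≈Q
  , A-ratio 8 P9≈Q P8≈Q
  , A-ratio 9 P10≈Q P9≈Q
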